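{- Each of the following classes has superSAP (with respect to the binary relation) and the joint embedding property (JEP); moreover, in each case the class of finite members has a Fraïssé limit, provided the sets $F$ and $G$ below are finite. (1) The classes of (a) partially ordered sets, (b) preordered sets, (c) undirected graphs (sets with a symmetric antireflexive binary relation), (d) directed graphs (sets with an antireflexive binary relation), (e) sets with an equivalence relation, (f) sets with a transitive binary relation, (g) sets with a symmetric and reflexive binary relation (a tolerance), even when there are added an $F$-indexed family of relation-preserving unary operations (i.e. $x\,R\,y$ implies $f(x)\,R\,f(y)$) and a $G$-indexed family of relation-reversing unary operations (i.e. $x\,R\,y$ implies $g(y)\,R\,g(x)$). (2) The class of partially ordered sets with further (indexed) families of order preserving, order reversing, strict order preserving and strict order reversing unary operations.
   Context: Classes are closed under isomorphism; substructures are closed under the operations. For a triple $\mathbf{A},\mathbf{B},\mathbf{C}\in\mathcal{K}$ with $\mathbf{C}\subseteq\mathbf{A}$, $\mathbf{C}\subseteq\mathbf{B}$, $C=A\cap B$, SAP asks for $\mathbf{D}\in\mathcal{K}$ with $\mathbf{A},\mathbf{B}\subseteq\mathbf{D}$; superSAP with respect to $R$ asks moreover that for $a\in A\setminus B$, $b\in B\setminus A$: if $a\,R_{\mathbf{D}}\,b$ there is $c\in C$ with $a\,R_{\mathbf{A}}\,c\,R_{\mathbf{B}}\,b$, and if $b\,R_{\mathbf{D}}\,a$ there is $c\in C$ with $b\,R_{\mathbf{B}}\,c\,R_{\mathbf{A}}\,a$. JEP: for every $\mathbf{A},\mathbf{B}\in\mathcal{K}$ there is $\mathbf{D}\in\mathcal{K}$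 into which both embed. For a poset, $f$ is order preserving if $a\le b\Rightarrow f(a)\le f(b)$, order reversing if $a\le b\Rightarrow f(b)\le f(a)$, strict order preserving if $a<b\Rightarrow f(a)<f(b)$, strict order reversing if $a<b\Rightarrow f(b)<f(a)$. A Fraïssé limit of a class of finitely generated structures in a countable language is a countable ultrahomogeneous structure whose age is that class. In (2), the finiteness proviso refers to the families of operations being finite. -}

module Defs where

open import Level using (0ℓ)
open import Data.Nat using (ℕ)
open import Data.Fin using (Fin)
open import Data.Product using (Σ; _×_; _,_; proj₁)
open import Data.Sum using (_⊎_; inj₁; inj₂)
open import Data.List using (List)
open import Data.List.Membership.Propositional using (_∈_)
open import Function.Bundles using (_↔_)
open import Relation.Nullary using (¬_)
open import Relation.Binary.PropositionalEquality using (_≡_)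

record Str (Op : Set) : Set₁ where
  field
    Carrier : Set
    R       : Carrier → Carrier → Set
    op      : Op → Carrier → Carrier

open Str public

-- A class of structures (closed under isomorphism: it is a predicate
-- defined by axioms, hence invariant under isomorphism).
Class : Set → Set₁
Class Op = Str Op → Set

record Emb {Op : Set} (A B : Str Op) : Set where
  field
    map  : Carrier A → Carrier B
    inj  : ∀ x y → map x ≡ map y → x ≡ y
    pres : ∀ x y → R A x y → R B (map x) (map y)
    reflect : ∀ x y → R B (map x) (map y) → R A x y
    hom  : ∀ o x → map (op A o x) ≡ op B o (map x)

open Emb public

InIm : {Op : Set} {A B : Str Op} → Emb A B → Carrier B → Set
InIm {A = A} e b = Σ (Carrier A) λ a → map e a ≡ b

Iso : {Op : Set} → Str Op → Str Op → Set
Iso A B = Σ (Emb A B) λ e → ∀ y → InIm e y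

-- Strong amalgamation with the "super" condition w.r.t. R
-- (C ⊆ A, C ⊆ B with C = A ∩ B, realised via embeddings i, j;
--  A, B ⊆ D with A ∩ B = C inside D).

SuperSAP : {Op : Set} → Class Op → Set₁
SuperSAP {Op} K =
  (A B C : Str Op) → K A → K B → K C → (i : Emb C A) (j : Emb C B) →
  Σ (Str Op) λ D → K D × Σ (Emb A D) λ e → Σ (Emb B D) λ h →
    (∀ c → map e (map i c) ≡ map h (map j c))
    × (∀ a b → map e a ≡ map h b → Σ (Carrier C) λ c → (map i c ≡ a) × (map j c ≡ b))
    × (∀ a b → ¬ InIm i a → ¬ InIm j b →
         (R D (map e a) (map h b) → Σ (Carrier C) λ c → R A a (map i c) × R B (map j c) b)
       × (R D (map h b) (map e a) → Σ (Carrier C) λ c → R B b (map j c) × R A (map i c) a))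

JEP : {Op : Set} → Class Op → Set₁
JEP {Op} K = (A B : Str Op) → K A → K B →
  Σ (Str Op) λ D → K D × Emb A D × Emb B D

FiniteSet : Set → Set
FiniteSet X = Σ ℕ λ n → X ↔ Fin n

FinClass : {Op : Set} → Class Op → Class Op
FinClass K A = K A × FiniteSet (Carrier A)

data Gen {Op : Set} (M : Str Op) (xs : List (Carrier M)) : Carrier M → Set where
  base : ∀ {x} → x ∈ xs → Gen M xs x
  step : ∀ o {x} → Gen M xs x → Gen M xs (op M o x)

FinGenSub : {Op : Set} {S M : Str Op} → Emb S M → Set
FinGenSub {S = S} {M = M} e = Σ (List (Carrier M)) λ xs →
  (∀ x → x ∈ xs → InIm e x) × (∀ s → Gen M xs (map e s))

Countable : {Op : Set} → Str Op → Set
Countable M = Σ (Carrier M → ℕ) λ f → ∀ x y → f x ≡ f y → x ≡ y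

Ultrahomogeneous : {Op : Set} → Str Op → Set₁
Ultrahomogeneous {Op} M =
  (S₁ S₂ : Str Op) (e₁ : Emb S₁ M) (e₂ : Emb S₂ M) →
  FinGenSub e₁ → FinGenSub e₂ → (φ : Iso S₁ S₂) →
  Σ (Iso M M) λ σ → ∀ s → map (proj₁ σ) (map e₁ s) ≡ map e₂ (map (proj₁ φ) s)

AgeIs : {Op : Set} → Str Op → Class Op → Set₁
AgeIs {Op} M K =
  ((A : Str Op) → K A → Emb A M)
  × ((S : Str Op) (e : Emb S M) → FinGenSub e → K S)

IsFraisseLimit : {Op : Set} → Class Op → Str Op → Set₁
IsFraisseLimit K M = Countable M × Ultrahomogeneous M × AgeIs M K

HasFraisseLimit : {Op : Set} → Class Op → Set₁
HasFraisseLimit {Op} K = Σ (Str Op) λ M → IsFraisseLimit K M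

data Kind : Set where
  poset preorder graph digraph equivalence transitive tolerance : Kind

Reflexive Symmetric Transitive Antisymmetric Irreflexive : {X : Set} → (X → X → Set) → Set
Reflexive   R = ∀ x → R x x
Symmetric   R = ∀ x y → R x y → R y x
Transitive  R = ∀ x y z → R x y → R y z → R x z
Antisymmetric R = ∀ x y → R x y → R y x → x ≡ y
Irreflexive R = ∀ x → ¬ R x x

RelAx : Kind → {X : Set} → (X → X → Set) → Set
RelAx poset       R = Reflexive R × Transitive R × Antisymmetric R
RelAx preorder    R = Reflexive R × Transitive R
RelAx graph       R = Symmetric R × Irreflexive R
RelAx digraph     R = Irreflexive R
RelAx equivalence R = Reflexive R × Symmetric R × Transitive R
RelAx transitive  R = Transitive R
RelAx tolerance   R = Symmetric R × Reflexive R

Preserving Reversing StrictPreserving StrictReversing :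
  {X : Set} → (X → X → Set) → (X → X) → Set
Preserving R f = ∀ x y → R x y → R (f x) (f y)
Reversing  R g = ∀ x y → R x y → R (g y) (g x)
StrictPreserving R f = ∀ x y → R x y × ¬ x ≡ y → R (f x) (f y) × ¬ f x ≡ f y
StrictReversing  R g = ∀ x y → R x y × ¬ x ≡ y → R (g y) (g x) × ¬ g y ≡ g x

Class1 : Kind → (F G : Set) → Class (F ⊎ G)
Class1 k F G A =
  RelAx k (R A)
  × (∀ f → Preserving (R A) (op A (inj₁ f)))
  × (∀ g → Reversing (R A) (op A (inj₂ g)))

Class2 : (F₁ F₂ F₃ F₄ : Set) → Class (F₁ ⊎ F₂ ⊎ F₃ ⊎ F₄)
Class2 F₁ F₂ F₃ F₄ A =
  RelAx poset (R A)
  × (∀ f → Preserving (R A) (op A (inj₁ f)))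
  × (∀ f → Reversing (R A) (op A (inj₂ (inj₁ f))))
  × (∀ f → StrictPreserving (R A) (op A (inj₂ (inj₂ (inj₁ f)))))
  × (∀ f → StrictReversing (R A) (op A (inj₂ (inj₂ (inj₂ f)))))

{-# OPTIONS --safe #-}
-- Over C ⊆ A, B each class is closed under the free amalgam on A ⊎ (B ∖ C), in which a point of A
-- lies below a point b of B ∖ C iff it lies below some point of C below b (only through equality,
-- for the intransitive kinds).  No relation across then avoids C, which is the super condition,
-- and amalgamating over ∅ gives JEP.  Strict operations stay strict because a strict pair across
-- passes through C with a strict step on the side of B.  The classes are hereditary and contain ∅,
-- and with finitely many operations the finite members are coded by an enumerable set of tables;
-- a chain of finite stages that solves every amalgamation task in turn then has the finite members
-- as its age, and its union is ultrahomogeneous by back and forth.  Excluded middle provides the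
-- complement B ∖ C and the truth tables of the codes.
module Submission where

open import Defs
open import Level using (0ℓ)
open import Axiom.ExcludedMiddle using (ExcludedMiddle)
open import Axiom.UniquenessOfIdentityProofs using (UIP; module Decidable⇒UIP)
open import Data.Bool as Bool using (Bool; true; false)
open import Data.Empty using (⊥; ⊥-elim)
open import Data.Unit using (⊤; tt)
open import Data.Product using (Σ; _×_; _,_; proj₁; proj₂)
open import Data.Sum using (_⊎_; inj₁; inj₂; [_,_]′)
open import Data.Sum.Properties using (inj₁-injective; inj₂-injective)
open import Data.Fin using (Fin; zero; suc; toℕ; fromℕ<)
open import Data.Fin.Properties using (+↔⊎; 0↔⊥; 2↔Bool; toℕ-↑ˡ; fromℕ<-toℕ; toℕ<n; toℕ-injective)
open import Data.List using (List; []; _∷_)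
open import Data.List.Membership.Propositional using (_∈_)
open import Data.List.Relation.Unary.Any using (here; there)
open import Data.Maybe as Maybe using (Maybe; just; nothing)
open import Data.Nat using (ℕ; zero; suc; _+_; _⊔_; _≤_; _<_; _≤′_; ≤′-refl; ≤′-step; _<?_; z≤n; s≤s)
open import Data.Nat.Properties using (+-suc; +-identityʳ; m≤n⇒m≤1+n; m≤n+m; ≤-trans; ≤-total; ≤⇒≤′; m≤m⊔n; m≤n⊔m)
open import Data.Vec using (Vec; []; _∷_; lookup; tabulate)
open import Data.Vec.Properties using (lookup∘tabulate)
open import Data.Sum.Function.Propositional using (_⊎-cong_)
open import Function using (_∘_)
open import Function.Bundles using (_↔_; Inverse; mk↔ₛ′)
open import Function.Properties.Inverse using (↔-refl; ↔-sym; ↔-trans)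
open import Relation.Nullary using (¬_; Dec; yes; no; does)
open import Relation.Binary.PropositionalEquality
  using (_≡_; refl; sym; trans; cong; cong₂; subst; subst₂; ≢-sym; module ≡-Reasoning)

open Inverse using (to; from; strictlyInverseˡ; strictlyInverseʳ)

Bool-uip : UIP Bool
Bool-uip = Decidable⇒UIP.≡-irrelevant Bool._≟_

subtype-≡ : {X : Set} {q : X → Bool} {b : Bool} {x y : X} {p : q x ≡ b} {p′ : q y ≡ b} →
            x ≡ y → _≡_ {A = Σ X λ x → q x ≡ b} (x , p) (y , p′)
subtype-≡ {p = p} {p′} refl = cong (_ ,_) (Bool-uip p p′)

module _ (lem : ExcludedMiddle 0ℓ) where

  ⌊_⌋ : Set → Bool
  ⌊ P ⌋ = does (lem {P})

  ⌊⌋≡true : {P : Set} → P → ⌊ P ⌋ ≡ true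
  ⌊⌋≡true {P} p with lem {P}
  ... | yes _ = refl
  ... | no ¬p = ⊥-elim (¬p p)

  ⌊⌋≡false : {P : Set} → ¬ P → ⌊ P ⌋ ≡ false
  ⌊⌋≡false {P} ¬p with lem {P}
  ... | yes p = ⊥-elim (¬p p)
  ... | no _ = refl

  ⌊⌋≡true⇒ : {P : Set} → ⌊ P ⌋ ≡ true → P
  ⌊⌋≡true⇒ {P} eq with lem {P}
  ... | yes p = p
  ⌊⌋≡true⇒ () | no _

  ⌊⌋≡false⇒ : {P : Set} → ⌊ P ⌋ ≡ false → ¬ P
  ⌊⌋≡false⇒ eq p with trans (sym (⌊⌋≡true p)) eq
  ... | ()

  strictPreserving⇒preserving : {X : Set} {R : X → X → Set} {f : X → X} →
                                Reflexive R → StrictPreserving R f → Preserving R f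
  strictPreserving⇒preserving {f = f} ρ sp x y r with lem {x ≡ y}
  ... | yes refl = ρ (f x)
  ... | no x≢y = proj₁ (sp x y (r , x≢y))

  strictReversing⇒reversing : {X : Set} {R : X → X → Set} {f : X → X} →
                              Reflexive R → StrictReversing R f → Reversing R f
  strictReversing⇒reversing {f = f} ρ sr x y r with lem {x ≡ y}
  ... | yes refl = ρ (f x)
  ... | no x≢y = proj₁ (sr x y (r , x≢y))

  module Complement {X Y : Set} (u : Y → X) (u-inj : ∀ {y y′} → u y ≡ u y′ → y ≡ y′) where

    InImage : X → Set
    InImage x = Σ Y λ y → u y ≡ x

    -- Membership is a Boolean equation, so equality in Rest is equality of the underlying points.
    Rest : Set
    Rest = Σ X λ x → ⌊ InImage x ⌋ ≡ false

    data View (x : X) : Set where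
      image : (y : Y) → u y ≡ x → View x
      rest  : ⌊ InImage x ⌋ ≡ false → View x

    view : ∀ x → View x
    view x with lem {InImage x}
    ... | yes (y , eq) = image y eq
    ... | no ¬im = rest (⌊⌋≡false ¬im)

    split : X → Y ⊎ Rest
    split x with view x
    ... | image y _ = inj₁ y
    ... | rest p = inj₂ (x , p)

    split-u : ∀ y → split (u y) ≡ inj₁ y
    split-u y with view (u y)
    ... | image y′ eq = cong inj₁ (u-inj eq)
    ... | rest p = ⊥-elim (⌊⌋≡false⇒ p (y , refl))

    split-rest : (r : Rest) → split (proj₁ r) ≡ inj₂ r
    split-rest (x , p) with view x
    ... | image y eq = ⊥-elim (⌊⌋≡false⇒ p (y , eq))
    ... | rest p′ = cong inj₂ (subtype-≡ refl)

    unsplit : Y ⊎ Rest → X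
    unsplit = [ u , proj₁ ]′

    unsplit-split : ∀ x → unsplit (split x) ≡ x
    unsplit-split x with view x
    ... | image y eq = eq
    ... | rest p = refl

    split-unsplit : ∀ z → split (unsplit z) ≡ z
    split-unsplit (inj₁ y) = split-u y
    split-unsplit (inj₂ r) = split-rest r

    split↔ : X ↔ (Y ⊎ Rest)
    split↔ = mk↔ₛ′ split unsplit split-unsplit unsplit-split

module _ {Op : Set} where

  idᴱ : {A : Str Op} → Emb A A
  idᴱ = record { map = λ x → x ; inj = λ _ _ eq → eq ; pres = λ _ _ r → r
               ; reflect = λ _ _ r → r ; hom = λ _ _ → refl }

  infixr 9 _∘ᴱ_
  _∘ᴱ_ : {A B C : Str Op} → Emb B C → Emb A B → Emb A C
  g ∘ᴱ f = record
    { map = map g ∘ map f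
    ; inj = λ x y eq → inj f x y (inj g _ _ eq)
    ; pres = λ x y r → pres g _ _ (pres f x y r)
    ; reflect = λ x y r → reflect f x y (reflect g _ _ r)
    ; hom = λ o x → trans (cong (map g) (hom f o x)) (hom g o (map f x)) }

  ∅ˢ : Str Op
  ∅ˢ = record { Carrier = ⊥ ; R = λ _ _ → ⊥ ; op = λ _ () }

  ∅ᴱ : {A : Str Op} → Emb ∅ˢ A
  ∅ᴱ = record { map = λ () ; inj = λ () ; pres = λ () ; reflect = λ () ; hom = λ _ () }

  transferᴱ : {A B C : Str Op} (e : Emb C A) (f : Emb C B) {x y : Carrier C} →
              R A (map e x) (map e y) → R B (map f x) (map f y)
  transferᴱ e f r = pres f _ _ (reflect e _ _ r)

  corestrict : {S T M : Str Op} (ι : Emb T M) (u : Emb S M) (g : Carrier S → Carrier T) →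
               (∀ a → map ι (g a) ≡ map u a) → Emb S T
  corestrict {S} {T} {M} ι u g eq = record
    { map = g
    ; inj = λ x y q → inj u x y (trans (sym (eq x)) (trans (cong (map ι) q) (eq y)))
    ; pres = λ x y r → reflect ι _ _ (subst₂ (R M) (sym (eq x)) (sym (eq y)) (pres u x y r))
    ; reflect = λ x y r → reflect u x y (subst₂ (R M) (eq x) (eq y) (pres ι _ _ r))
    ; hom = λ o x → inj ι _ _ (trans (eq (op S o x))
                     (trans (hom u o x) (trans (cong (op M o) (sym (eq x))) (sym (hom ι o (g x)))))) }

OrEq : Set → {X : Set} → (X → X → Set) → X → X → Set
OrEq G R x y = x ≡ y ⊎ (G × R x y)

module _ {G X : Set} {R : X → X → Set} where

  OrEq-transˡ : (G → Transitive R) → ∀ {x y z} → OrEq G R x y → R y z → R x z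
  OrEq-transˡ t (inj₁ refl) r = r
  OrEq-transˡ t (inj₂ (g , r₁)) r = t g _ _ _ r₁ r

  OrEq-transʳ : (G → Transitive R) → ∀ {x y z} → R x y → OrEq G R y z → R x z
  OrEq-transʳ t r (inj₁ refl) = r
  OrEq-transʳ t r (inj₂ (g , r₁)) = t g _ _ _ r r₁

  OrEq-trans : (G → Transitive R) → ∀ {x y z} → OrEq G R x y → OrEq G R y z → OrEq G R x z
  OrEq-trans t (inj₁ refl) l = l
  OrEq-trans t (inj₂ (g , r)) l = inj₂ (g , OrEq-transʳ t r l)

  OrEq-sym : Symmetric R → ∀ {x y} → OrEq G R x y → OrEq G R y x
  OrEq-sym s (inj₁ eq) = inj₁ (sym eq)
  OrEq-sym s (inj₂ (g , r)) = inj₂ (g , s _ _ r)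

  OrEq⇒ : Reflexive R → ∀ {x y} → OrEq G R x y → R x y
  OrEq⇒ ρ (inj₁ refl) = ρ _
  OrEq⇒ ρ (inj₂ (_ , r)) = r

  OrEq-preserving : {f : X → X} → Preserving R f → ∀ {x y} → OrEq G R x y → OrEq G R (f x) (f y)
  OrEq-preserving {f} p (inj₁ eq) = inj₁ (cong f eq)
  OrEq-preserving p (inj₂ (g , r)) = inj₂ (g , p _ _ r)

  OrEq-reversing : {f : X → X} → Reversing R f → ∀ {x y} → OrEq G R x y → OrEq G R (f y) (f x)
  OrEq-reversing {f} p (inj₁ eq) = inj₁ (cong f (sym eq))
  OrEq-reversing p (inj₂ (g , r)) = inj₂ (g , p _ _ r)

inj₁≢inj₂ : {X Y : Set} {x : X} {y : Y} → ¬ _≡_ {A = X ⊎ Y} (inj₁ x) (inj₂ y)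
inj₁≢inj₂ ()

module _ {X Y : Set} {R : X → X → Set} {S : Y → Y → Set} (antisym : Antisymmetric S)
         {f : X → Y} (mono : ∀ x y → R x y → S (f x) (f y)) where

  mono-separatesʳ : ∀ {x y z} → R x z → R z y → ¬ f z ≡ f y → ¬ f x ≡ f y
  mono-separatesʳ {x} {y} {z} xz zy fz≢fy fx≡fy =
    fz≢fy (antisym _ _ (mono z y zy) (subst (λ w → S w (f z)) fx≡fy (mono x z xz)))

  mono-separatesˡ : ∀ {x y z} → R x z → R z y → ¬ f x ≡ f z → ¬ f x ≡ f y
  mono-separatesˡ {x} {y} {z} xz zy fx≢fz fx≡fy =
    fx≢fz (antisym _ _ (mono x z xz) (subst (S (f z)) (sym fx≡fy) (mono z y zy)))

-- Glue holds for the transitive kinds; otherwise ⊑ is equality and nothing is glued across C.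
module Amalgam (lem : ExcludedMiddle 0ℓ) {Op : Set} {A B C : Str Op} (i : Emb C A) (j : Emb C B)
  (Glue : Set) (transA : Glue → Transitive (R A)) (transB : Glue → Transitive (R B)) where

  open Complement lem (map j) (λ {c} {c′} → inj j c c′) public

  _⊑_ : Carrier A → Carrier A → Set
  _⊑_ = OrEq Glue (R A)

  Below : Carrier A → Carrier B → Set
  Below a b = Σ (Carrier C) λ c → a ⊑ map i c × R B (map j c) b

  Above : Carrier B → Carrier A → Set
  Above b a = Σ (Carrier C) λ c → R B b (map j c) × map i c ⊑ a

  Rᴰ : Carrier A ⊎ Rest → Carrier A ⊎ Rest → Set
  Rᴰ (inj₁ a) (inj₁ a′) = R A a a′
  Rᴰ (inj₁ a) (inj₂ (b , _)) = Below a b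
  Rᴰ (inj₂ (b , _)) (inj₁ a) = Above b a
  Rᴰ (inj₂ (b , _)) (inj₂ (b′ , _)) = R B b b′

  fromB : Carrier B → Carrier A ⊎ Rest
  fromB = [ inj₁ ∘ map i , inj₂ ]′ ∘ split

  opᴰ : Op → Carrier A ⊎ Rest → Carrier A ⊎ Rest
  opᴰ o (inj₁ a) = inj₁ (op A o a)
  opᴰ o (inj₂ (b , _)) = fromB (op B o b)

  D : Str Op
  D = record { Carrier = Carrier A ⊎ Rest ; R = Rᴰ ; op = opᴰ }

  fromB-j : ∀ c → fromB (map j c) ≡ inj₁ (map i c)
  fromB-j c = cong [ inj₁ ∘ map i , inj₂ ]′ (split-u c)

  ⊑-transfer : ∀ {c c′} → map i c ⊑ map i c′ → OrEq Glue (R B) (map j c) (map j c′)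
  ⊑-transfer (inj₁ eq) = inj₁ (cong (map j) (inj i _ _ eq))
  ⊑-transfer (inj₂ (g , r)) = inj₂ (g , transferᴱ i j r)

  Below⇒Rᴰ : ∀ {a b} → Below a b → Rᴰ (inj₁ a) (fromB b)
  Below⇒Rᴰ {a} {b} below with view b
  ... | image c refl = let (c′ , le , r) = below in OrEq-transˡ transA le (transferᴱ j i r)
  ... | rest _ = below

  Above⇒Rᴰ : ∀ {a b} → Above b a → Rᴰ (fromB b) (inj₁ a)
  Above⇒Rᴰ {a} {b} above with view b
  ... | image c refl = let (c′ , r , le) = above in OrEq-transʳ transA (transferᴱ j i r) le
  ... | rest _ = above

  fromA : Emb A D
  fromA = record { map = inj₁ ; inj = λ _ _ → inj₁-injective ; pres = λ _ _ r → r
                 ; reflect = λ _ _ r → r ; hom = λ _ _ → refl }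

  fromB-pres : ∀ b b′ → R B b b′ → Rᴰ (fromB b) (fromB b′)
  fromB-pres b b′ r with view b | view b′
  ... | image c refl | image c′ refl = transferᴱ j i r
  ... | image c refl | rest _ = c , inj₁ refl , r
  ... | rest _ | image c′ refl = c′ , r , inj₁ refl
  ... | rest _ | rest _ = r

  fromB-reflect : ∀ b b′ → Rᴰ (fromB b) (fromB b′) → R B b b′
  fromB-reflect b b′ r with view b | view b′
  ... | image c refl | image c′ refl = transferᴱ i j r
  ... | image c refl | rest _ = let (c″ , le , r′) = r in OrEq-transˡ transB (⊑-transfer le) r′
  ... | rest _ | image c′ refl = let (c″ , r′ , le) = r in OrEq-transʳ transB r′ (⊑-transfer le)
  ... | rest _ | rest _ = r

  fromB-inj : ∀ b b′ → fromB b ≡ fromB b′ → b ≡ b′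
  fromB-inj b b′ eq with view b | view b′
  ... | image c refl | image c′ refl = cong (map j) (inj i c c′ (inj₁-injective eq))
  ... | image c refl | rest _ = ⊥-elim (inj₁≢inj₂ eq)
  ... | rest _ | image c′ refl = ⊥-elim (inj₁≢inj₂ (sym eq))
  ... | rest _ | rest _ = cong proj₁ (inj₂-injective eq)

  fromB-hom : ∀ o b → fromB (op B o b) ≡ opᴰ o (fromB b)
  fromB-hom o b with view b
  ... | image c refl = begin
      fromB (op B o (map j c))  ≡⟨ cong fromB (sym (hom j o c)) ⟩
      fromB (map j (op C o c))  ≡⟨ fromB-j (op C o c) ⟩
      inj₁ (map i (op C o c))   ≡⟨ cong inj₁ (hom i o c) ⟩
      inj₁ (op A o (map i c))   ∎
    where open ≡-Reasoning
  ... | rest _ = refl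

  fromBᴱ : Emb B D
  fromBᴱ = record { map = fromB ; inj = fromB-inj ; pres = fromB-pres
                  ; reflect = fromB-reflect ; hom = fromB-hom }

  commutes : ∀ c → map fromA (map i c) ≡ fromB (map j c)
  commutes c = sym (fromB-j c)

  meet : ∀ a b → map fromA a ≡ fromB b → Σ (Carrier C) λ c → (map i c ≡ a) × (map j c ≡ b)
  meet a b eq with view b
  ... | image c refl = c , sym (inj₁-injective eq) , refl
  ... | rest _ = ⊥-elim (inj₁≢inj₂ eq)

  super : ∀ a b → ¬ InIm i a → ¬ InIm j b →
          (Rᴰ (inj₁ a) (fromB b) → Σ (Carrier C) λ c → R A a (map i c) × R B (map j c) b)
        × (Rᴰ (fromB b) (inj₁ a) → Σ (Carrier C) λ c → R B b (map j c) × R A (map i c) a)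
  super a b a∉C b∉C with view b
  ... | image c eq = ⊥-elim (b∉C (c , eq))
  ... | rest _ = strictBelow , strictAbove
    where
    strictBelow : Below a b → Σ (Carrier C) λ c → R A a (map i c) × R B (map j c) b
    strictBelow (c , inj₁ eq , r) = ⊥-elim (a∉C (c , sym eq))
    strictBelow (c , inj₂ (_ , r′) , r) = c , r′ , r
    strictAbove : Above b a → Σ (Carrier C) λ c → R B b (map j c) × R A (map i c) a
    strictAbove (c , r , inj₁ eq) = ⊥-elim (a∉C (c , eq))
    strictAbove (c , r , inj₂ (_ , r′)) = c , r , r′

  reflᴰ : Reflexive (R A) → Reflexive (R B) → Reflexive Rᴰ
  reflᴰ ρA ρB (inj₁ a) = ρA a
  reflᴰ ρA ρB (inj₂ (b , _)) = ρB b

  symᴰ : Symmetric (R A) → Symmetric (R B) → Symmetric Rᴰ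
  symᴰ σA σB (inj₁ a) (inj₁ a′) r = σA a a′ r
  symᴰ σA σB (inj₁ a) (inj₂ _) (c , le , r) = c , σB _ _ r , OrEq-sym σA le
  symᴰ σA σB (inj₂ _) (inj₁ a) (c , r , le) = c , OrEq-sym σA le , σB _ _ r
  symᴰ σA σB (inj₂ (b , _)) (inj₂ (b′ , _)) r = σB b b′ r

  irreflᴰ : Irreflexive (R A) → Irreflexive (R B) → Irreflexive Rᴰ
  irreflᴰ ιA ιB (inj₁ a) = ιA a
  irreflᴰ ιA ιB (inj₂ (b , _)) = ιB b

  transᴰ : Glue → Transitive Rᴰ
  transᴰ g (inj₁ _) (inj₁ _) (inj₁ _) r₁ r₂ = transA g _ _ _ r₁ r₂
  transᴰ g (inj₁ _) (inj₁ _) (inj₂ _) r₁ (c , le , r₂) = c , inj₂ (g , OrEq-transʳ transA r₁ le) , r₂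
  transᴰ g (inj₁ _) (inj₂ _) (inj₁ _) (c , le , r₁) (c′ , r₂ , le′) =
    OrEq-transˡ transA le (OrEq-transʳ transA (transferᴱ j i (transB g _ _ _ r₁ r₂)) le′)
  transᴰ g (inj₁ _) (inj₂ _) (inj₂ _) (c , le , r₁) r₂ = c , le , transB g _ _ _ r₁ r₂
  transᴰ g (inj₂ _) (inj₁ _) (inj₁ _) (c , r₁ , le) r₂ = c , r₁ , inj₂ (g , OrEq-transˡ transA le r₂)
  transᴰ g (inj₂ _) (inj₁ _) (inj₂ _) (c , r₁ , le) (c′ , le′ , r₂) =
    transB g _ _ _ r₁ (OrEq-transˡ transB (⊑-transfer (OrEq-trans transA le le′)) r₂)
  transᴰ g (inj₂ _) (inj₂ _) (inj₁ _) r₁ (c , r₂ , le) = c , transB g _ _ _ r₁ r₂ , le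
  transᴰ g (inj₂ _) (inj₂ _) (inj₂ _) r₁ r₂ = transB g _ _ _ r₁ r₂

  below-above⇒InImage : Antisymmetric (R B) → ∀ {a b} → Below a b → Above b a → InImage b
  below-above⇒InImage αB (c , le , r) (c′ , r′ , le′) =
    c , αB _ _ r (OrEq-transʳ transB r′ (⊑-transfer (OrEq-trans transA le′ le)))

  antisymᴰ : Antisymmetric (R A) → Antisymmetric (R B) → Antisymmetric Rᴰ
  antisymᴰ αA αB (inj₁ a) (inj₁ a′) r₁ r₂ = cong inj₁ (αA a a′ r₁ r₂)
  antisymᴰ αA αB (inj₁ _) (inj₂ (b , b∉C)) r₁ r₂ =
    ⊥-elim (⌊⌋≡false⇒ lem b∉C (below-above⇒InImage αB r₁ r₂))
  antisymᴰ αA αB (inj₂ (b , b∉C)) (inj₁ _) r₁ r₂ =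
    ⊥-elim (⌊⌋≡false⇒ lem b∉C (below-above⇒InImage αB r₂ r₁))
  antisymᴰ αA αB (inj₂ (b , _)) (inj₂ (b′ , _)) r₁ r₂ = cong inj₂ (subtype-≡ (αB b b′ r₁ r₂))

  module _ {o : Op} (pA : Preserving (R A) (op A o)) (pB : Preserving (R B) (op B o)) where

    Below-pres : ∀ {a b} → Below a b → Below (op A o a) (op B o b)
    Below-pres (c , le , r) = op C o c
      , subst (op A o _ ⊑_) (sym (hom i o c)) (OrEq-preserving pA le)
      , subst (λ x → R B x _) (sym (hom j o c)) (pB _ _ r)

    Above-pres : ∀ {a b} → Above b a → Above (op B o b) (op A o a)
    Above-pres (c , r , le) = op C o c
      , subst (R B _) (sym (hom j o c)) (pB _ _ r)
      , subst (_⊑ op A o _) (sym (hom i o c)) (OrEq-preserving pA le)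

    presᴰ : Preserving Rᴰ (opᴰ o)
    presᴰ (inj₁ a) (inj₁ a′) r = pA a a′ r
    presᴰ (inj₁ _) (inj₂ _) r = Below⇒Rᴰ (Below-pres r)
    presᴰ (inj₂ _) (inj₁ _) r = Above⇒Rᴰ (Above-pres r)
    presᴰ (inj₂ (b , _)) (inj₂ (b′ , _)) r = fromB-pres _ _ (pB b b′ r)

  module _ {o : Op} (rA : Reversing (R A) (op A o)) (rB : Reversing (R B) (op B o)) where

    Below-rev : ∀ {a b} → Below a b → Above (op B o b) (op A o a)
    Below-rev (c , le , r) = op C o c
      , subst (R B _) (sym (hom j o c)) (rB _ _ r)
      , subst (_⊑ op A o _) (sym (hom i o c)) (OrEq-reversing rA le)

    Above-rev : ∀ {a b} → Above b a → Below (op A o a) (op B o b)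
    Above-rev (c , r , le) = op C o c
      , subst (op A o _ ⊑_) (sym (hom i o c)) (OrEq-reversing rA le)
      , subst (λ x → R B x _) (sym (hom j o c)) (rB _ _ r)

    revᴰ : Reversing Rᴰ (opᴰ o)
    revᴰ (inj₁ a) (inj₁ a′) r = rA a a′ r
    revᴰ (inj₁ _) (inj₂ _) r = Above⇒Rᴰ (Below-rev r)
    revᴰ (inj₂ _) (inj₁ _) r = Below⇒Rᴰ (Above-rev r)
    revᴰ (inj₂ (b , _)) (inj₂ (b′ , _)) r = fromB-pres _ _ (rB b b′ r)

  opᴰ-i≡fromB-j : ∀ o c → opᴰ o (inj₁ (map i c)) ≡ fromB (op B o (map j c))
  opᴰ-i≡fromB-j o c = trans (cong (opᴰ o) (sym (fromB-j c))) (sym (fromB-hom o (map j c)))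

  -- A pair across passes through some i c with j c ≠ b, which op o does not collapse in B.
  module _ {o : Op} (ρA : Reflexive (R A)) {S : Carrier A ⊎ Rest → Carrier A ⊎ Rest → Set}
           (αS : Antisymmetric S) (mono : ∀ x y → Rᴰ x y → S (opᴰ o x) (opᴰ o y))
           (sepA : ∀ a a′ → R A a a′ → ¬ a ≡ a′ → ¬ op A o a ≡ op A o a′)
           (sepB : ∀ b b′ → R B b b′ → ¬ b ≡ b′ → ¬ op B o b ≡ op B o b′) where

    separatesᴰ : ∀ x y → Rᴰ x y → ¬ x ≡ y → ¬ opᴰ o x ≡ opᴰ o y
    separatesᴰ (inj₁ a) (inj₁ a′) r a≢a′ = sepA a a′ r (a≢a′ ∘ cong inj₁) ∘ inj₁-injective
    separatesᴰ (inj₁ a) (inj₂ (b , b∉C)) (c , le , r) _ =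
      mono-separatesʳ αS mono {inj₁ a} {inj₂ (b , b∉C)} {inj₁ (map i c)}
        (OrEq⇒ {R = R A} ρA le) (c , inj₁ refl , r)
        (λ eq → sepB _ _ r (λ jc≡b → ⌊⌋≡false⇒ lem b∉C (c , jc≡b))
                  (fromB-inj _ _ (trans (sym (opᴰ-i≡fromB-j o c)) eq)))
    separatesᴰ (inj₂ (b , b∉C)) (inj₁ a) (c , r , le) _ =
      mono-separatesˡ αS mono {inj₂ (b , b∉C)} {inj₁ a} {inj₁ (map i c)}
        (c , r , inj₁ refl) (OrEq⇒ {R = R A} ρA le)
        (λ eq → sepB _ _ r (λ b≡jc → ⌊⌋≡false⇒ lem b∉C (c , sym b≡jc))
                  (fromB-inj _ _ (trans eq (opᴰ-i≡fromB-j o c))))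
    separatesᴰ (inj₂ (b , _)) (inj₂ (b′ , _)) r b≢b′ =
      sepB b b′ r (b≢b′ ∘ cong inj₂ ∘ subtype-≡) ∘ fromB-inj _ _

  module _ (ρA : Reflexive (R A)) (ρB : Reflexive (R B))
           (αA : Antisymmetric (R A)) (αB : Antisymmetric (R B)) {o : Op} where

    strictPresᴰ : StrictPreserving (R A) (op A o) → StrictPreserving (R B) (op B o) →
                  StrictPreserving Rᴰ (opᴰ o)
    strictPresᴰ sA sB x y (r , x≢y) = mono x y r ,
      separatesᴰ ρA (antisymᴰ αA αB) mono
        (λ a a′ r a≢a′ → proj₂ (sA a a′ (r , a≢a′)))
        (λ b b′ r b≢b′ → proj₂ (sB b b′ (r , b≢b′)))
        x y r x≢y
      where mono = presᴰ (strictPreserving⇒preserving lem ρA sA) (strictPreserving⇒preserving lem ρB sB)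

    strictRevᴰ : StrictReversing (R A) (op A o) → StrictReversing (R B) (op B o) →
                 StrictReversing Rᴰ (opᴰ o)
    strictRevᴰ sA sB x y (r , x≢y) = mono x y r ,
      ≢-sym (separatesᴰ ρA (λ x y r₁ r₂ → antisymᴰ αA αB x y r₂ r₁) mono
        (λ a a′ r a≢a′ → ≢-sym (proj₂ (sA a a′ (r , a≢a′))))
        (λ b b′ r b≢b′ → ≢-sym (proj₂ (sB b b′ (r , b≢b′))))
        x y r x≢y)
      where mono = revᴰ (strictReversing⇒reversing lem ρA sA) (strictReversing⇒reversing lem ρB sB)

module _ {Op : Set} {S T : Str Op} (e : Emb S T) where

  reflexive⁻ : Reflexive (R T) → Reflexive (R S)
  reflexive⁻ ρ x = reflect e x x (ρ _)

  symmetric⁻ : Symmetric (R T) → Symmetric (R S)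
  symmetric⁻ σ x y r = reflect e y x (σ _ _ (pres e x y r))

  transitive⁻ : Transitive (R T) → Transitive (R S)
  transitive⁻ τ x y z r₁ r₂ = reflect e x z (τ _ _ _ (pres e x y r₁) (pres e y z r₂))

  antisymmetric⁻ : Antisymmetric (R T) → Antisymmetric (R S)
  antisymmetric⁻ α x y r₁ r₂ = inj e x y (α _ _ (pres e x y r₁) (pres e y x r₂))

  irreflexive⁻ : Irreflexive (R T) → Irreflexive (R S)
  irreflexive⁻ ι x r = ι _ (pres e x x r)

  R-op⁻ : ∀ o {x y} → R T (op T o (map e x)) (op T o (map e y)) → R S (op S o x) (op S o y)
  R-op⁻ o {x} {y} r = reflect e _ _ (subst₂ (R T) (sym (hom e o x)) (sym (hom e o y)) r)

  ≢-op⁻ : ∀ o {x y} → ¬ op T o (map e x) ≡ op T o (map e y) → ¬ op S o x ≡ op S o y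
  ≢-op⁻ o {x} {y} ne eq = ne (trans (sym (hom e o x)) (trans (cong (map e) eq) (hom e o y)))

  preserving⁻ : ∀ o → Preserving (R T) (op T o) → Preserving (R S) (op S o)
  preserving⁻ o p x y r = R-op⁻ o (p _ _ (pres e x y r))

  reversing⁻ : ∀ o → Reversing (R T) (op T o) → Reversing (R S) (op S o)
  reversing⁻ o p x y r = R-op⁻ o (p _ _ (pres e x y r))

  strictPreserving⁻ : ∀ o → StrictPreserving (R T) (op T o) → StrictPreserving (R S) (op S o)
  strictPreserving⁻ o p x y (r , x≢y) =
    let (r′ , ne) = p _ _ (pres e x y r , x≢y ∘ inj e x y) in R-op⁻ o r′ , ≢-op⁻ o ne

  strictReversing⁻ : ∀ o → StrictReversing (R T) (op T o) → StrictReversing (R S) (op S o)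
  strictReversing⁻ o p x y (r , x≢y) =
    let (r′ , ne) = p _ _ (pres e x y r , x≢y ∘ inj e x y) in R-op⁻ o r′ , ≢-op⁻ o ne

  RelAx⁻ : ∀ k → RelAx k (R T) → RelAx k (R S)
  RelAx⁻ poset (ρ , τ , α) = reflexive⁻ ρ , transitive⁻ τ , antisymmetric⁻ α
  RelAx⁻ preorder (ρ , τ) = reflexive⁻ ρ , transitive⁻ τ
  RelAx⁻ graph (σ , ι) = symmetric⁻ σ , irreflexive⁻ ι
  RelAx⁻ digraph ι = irreflexive⁻ ι
  RelAx⁻ equivalence (ρ , σ , τ) = reflexive⁻ ρ , symmetric⁻ σ , transitive⁻ τ
  RelAx⁻ transitive τ = transitive⁻ τ
  RelAx⁻ tolerance (σ , ρ) = symmetric⁻ σ , reflexive⁻ ρ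

Class1-hereditary : ∀ k F G {S T : Str (F ⊎ G)} → Emb S T → Class1 k F G T → Class1 k F G S
Class1-hereditary k F G e (ax , p , r) =
  RelAx⁻ e k ax , (λ f → preserving⁻ e (inj₁ f) (p f)) , (λ g → reversing⁻ e (inj₂ g) (r g))

Class2-hereditary : ∀ F₁ F₂ F₃ F₄ {S T : Str (F₁ ⊎ F₂ ⊎ F₃ ⊎ F₄)} → Emb S T →
                    Class2 F₁ F₂ F₃ F₄ T → Class2 F₁ F₂ F₃ F₄ S
Class2-hereditary F₁ F₂ F₃ F₄ e (ax , p , r , sp , sr) =
  RelAx⁻ e poset ax , (λ f → preserving⁻ e _ (p f)) , (λ f → reversing⁻ e _ (r f))
  , (λ f → strictPreserving⁻ e _ (sp f)) , (λ f → strictReversing⁻ e _ (sr f))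

RelAx-∅ : ∀ {Op} k → RelAx k (R (∅ˢ {Op}))
RelAx-∅ poset = (λ ()) , (λ ()) , (λ ())
RelAx-∅ preorder = (λ ()) , (λ ())
RelAx-∅ graph = (λ ()) , (λ ())
RelAx-∅ digraph = λ ()
RelAx-∅ equivalence = (λ ()) , (λ ()) , (λ ())
RelAx-∅ transitive = λ ()
RelAx-∅ tolerance = (λ ()) , (λ ())

Class1-∅ : ∀ k F G → Class1 k F G ∅ˢ
Class1-∅ k F G = RelAx-∅ {F ⊎ G} k , (λ _ ()) , (λ _ ())

Class2-∅ : ∀ F₁ F₂ F₃ F₄ → Class2 F₁ F₂ F₃ F₄ ∅ˢ
Class2-∅ F₁ F₂ F₃ F₄ = RelAx-∅ {F₁ ⊎ F₂ ⊎ F₃ ⊎ F₄} poset , (λ _ ()) , (λ _ ()) , (λ _ ()) , (λ _ ())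

TransitiveKind : Kind → Set
TransitiveKind poset = ⊤
TransitiveKind preorder = ⊤
TransitiveKind graph = ⊥
TransitiveKind digraph = ⊥
TransitiveKind equivalence = ⊤
TransitiveKind transitive = ⊤
TransitiveKind tolerance = ⊥

RelAx⇒transitive : ∀ k {X : Set} {R : X → X → Set} → RelAx k R → TransitiveKind k → Transitive R
RelAx⇒transitive poset (_ , τ , _) _ = τ
RelAx⇒transitive preorder (_ , τ) _ = τ
RelAx⇒transitive equivalence (_ , _ , τ) _ = τ
RelAx⇒transitive transitive τ _ = τ

module _ (lem : ExcludedMiddle 0ℓ) {Op : Set} {A B C : Str Op} (i : Emb C A) (j : Emb C B) where

  RelAx-amalgam : ∀ k (axA : RelAx k (R A)) (axB : RelAx k (R B)) →
    RelAx k (R (Amalgam.D lem i j (TransitiveKind k) (RelAx⇒transitive k axA) (RelAx⇒transitive k axB)))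
  RelAx-amalgam poset axA@(ρA , _ , αA) axB@(ρB , _ , αB) = reflᴰ ρA ρB , transᴰ tt , antisymᴰ αA αB
    where open Amalgam lem i j ⊤ (RelAx⇒transitive poset axA) (RelAx⇒transitive poset axB)
  RelAx-amalgam preorder axA@(ρA , _) axB@(ρB , _) = reflᴰ ρA ρB , transᴰ tt
    where open Amalgam lem i j ⊤ (RelAx⇒transitive preorder axA) (RelAx⇒transitive preorder axB)
  RelAx-amalgam graph axA@(σA , ιA) axB@(σB , ιB) = symᴰ σA σB , irreflᴰ ιA ιB
    where open Amalgam lem i j ⊥ (RelAx⇒transitive graph axA) (RelAx⇒transitive graph axB)
  RelAx-amalgam digraph ιA ιB = irreflᴰ ιA ιB
    where open Amalgam lem i j ⊥ (RelAx⇒transitive digraph ιA) (RelAx⇒transitive digraph ιB)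
  RelAx-amalgam equivalence axA@(ρA , σA , _) axB@(ρB , σB , _) = reflᴰ ρA ρB , symᴰ σA σB , transᴰ tt
    where open Amalgam lem i j ⊤ (RelAx⇒transitive equivalence axA) (RelAx⇒transitive equivalence axB)
  RelAx-amalgam transitive τA τB = transᴰ tt
    where open Amalgam lem i j ⊤ (RelAx⇒transitive transitive τA) (RelAx⇒transitive transitive τB)
  RelAx-amalgam tolerance axA@(σA , ρA) axB@(σB , ρB) = symᴰ σA σB , reflᴰ ρA ρB
    where open Amalgam lem i j ⊥ (RelAx⇒transitive tolerance axA) (RelAx⇒transitive tolerance axB)

ClosedUnderAmalgams : ExcludedMiddle 0ℓ → {Op : Set} (K : Class Op) (G : Set) →
                      (∀ {A} → K A → G → Transitive (R A)) → Set₁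
ClosedUnderAmalgams lem K G trans = ∀ {A B C} (i : Emb C A) (j : Emb C B) (kA : K A) (kB : K B) →
  K (Amalgam.D lem i j G (trans kA) (trans kB))

Class1-amalgam : (lem : ExcludedMiddle 0ℓ) → ∀ k F G →
  ClosedUnderAmalgams lem (Class1 k F G) (TransitiveKind k) (λ kA → RelAx⇒transitive k (proj₁ kA))
Class1-amalgam lem k F G i j (axA , pA , rA) (axB , pB , rB) =
  RelAx-amalgam lem i j k axA axB , (λ f → presᴰ (pA f) (pB f)) , (λ g → revᴰ (rA g) (rB g))
  where open Amalgam lem i j (TransitiveKind k) (RelAx⇒transitive k axA) (RelAx⇒transitive k axB)

Class2-amalgam : (lem : ExcludedMiddle 0ℓ) → ∀ F₁ F₂ F₃ F₄ →
  ClosedUnderAmalgams lem (Class2 F₁ F₂ F₃ F₄) ⊤ (λ kA → RelAx⇒transitive poset (proj₁ kA))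
Class2-amalgam lem F₁ F₂ F₃ F₄ i j
  (axA@(ρA , _ , αA) , pA , rA , spA , srA) (axB@(ρB , _ , αB) , pB , rB , spB , srB) =
  RelAx-amalgam lem i j poset axA axB , (λ f → presᴰ (pA f) (pB f)) , (λ f → revᴰ (rA f) (rB f))
  , (λ f → strictPresᴰ ρA ρB αA αB (spA f) (spB f)) , (λ f → strictRevᴰ ρA ρB αA αB (srA f) (srB f))
  where open Amalgam lem i j ⊤ (RelAx⇒transitive poset axA) (RelAx⇒transitive poset axB)

FiniteSet-↔ : {X Y : Set} → X ↔ Y → FiniteSet Y → FiniteSet X
FiniteSet-↔ X↔Y (n , Y↔n) = n , ↔-trans X↔Y Y↔n

FiniteSet-Fin : ∀ n → FiniteSet (Fin n)
FiniteSet-Fin n = n , ↔-refl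

FiniteSet-⊎ : {X Y : Set} → FiniteSet X → FiniteSet Y → FiniteSet (X ⊎ Y)
FiniteSet-⊎ (m , X↔m) (n , Y↔n) = m + n , ↔-trans (X↔m ⊎-cong Y↔n) (↔-sym +↔⊎)

Σ-Fin-suc↔ : {n : ℕ} {P : Fin (suc n) → Set} → Σ (Fin (suc n)) P ↔ (P zero ⊎ Σ (Fin n) (P ∘ suc))
Σ-Fin-suc↔ = mk↔ₛ′ (λ { (zero , p) → inj₁ p ; (suc x , p) → inj₂ (x , p) })
                   [ (zero ,_) , (λ (x , p) → suc x , p) ]′
                   (λ { (inj₁ _) → refl ; (inj₂ _) → refl })
                   (λ { (zero , _) → refl ; (suc _ , _) → refl })

FiniteSet-Fin-subset : ∀ n (q : Fin n → Bool) b → FiniteSet (Σ (Fin n) λ x → q x ≡ b)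
FiniteSet-Fin-subset zero q b = 0 , mk↔ₛ′ (λ ()) (λ ()) (λ ()) (λ ())
FiniteSet-Fin-subset (suc n) q b =
  FiniteSet-↔ Σ-Fin-suc↔ (FiniteSet-⊎ at-zero (FiniteSet-Fin-subset n (q ∘ suc) b))
  where
  at-zero : FiniteSet (q zero ≡ b)
  at-zero with q zero Bool.≟ b
  ... | yes q0≡b = 1 , mk↔ₛ′ (λ _ → zero) (λ _ → q0≡b) (λ { zero → refl }) (Bool-uip q0≡b)
  ... | no q0≢b = 0 , mk↔ₛ′ (⊥-elim ∘ q0≢b) (λ ()) (λ ()) (⊥-elim ∘ q0≢b)

FiniteSet-subset : {X : Set} → FiniteSet X → (q : X → Bool) (b : Bool) → FiniteSet (Σ X λ x → q x ≡ b)
FiniteSet-subset {X} (n , β) q b = FiniteSet-↔ restrict↔ (FiniteSet-Fin-subset n (q ∘ from β) b)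
  where
  restrict↔ : (Σ X λ x → q x ≡ b) ↔ (Σ (Fin n) λ y → q (from β y) ≡ b)
  restrict↔ = mk↔ₛ′ (λ (x , p) → to β x , subst (λ z → q z ≡ b) (sym (strictlyInverseʳ β x)) p)
                    (λ (y , p) → from β y , p)
                    (λ (y , _) → subtype-≡ (strictlyInverseˡ β y))
                    (λ (x , _) → subtype-≡ (strictlyInverseʳ β x))

FiniteSet-injection : ExcludedMiddle 0ℓ → {X Y : Set} → FiniteSet Y →
                      (f : X → Y) → (∀ {x x′} → f x ≡ f x′ → x ≡ x′) → FiniteSet X
FiniteSet-injection lem {X} {Y} fY f f-inj =
  FiniteSet-↔ image↔ (FiniteSet-subset fY (λ y → ⌊_⌋ lem (InImage y)) true)
  where
  open Complement lem f f-inj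
  image↔ : X ↔ (Σ Y λ y → ⌊_⌋ lem (InImage y) ≡ true)
  image↔ = mk↔ₛ′ (λ x → f x , ⌊⌋≡true lem (x , refl)) (λ (_ , p) → proj₁ (⌊⌋≡true⇒ lem p))
                 (λ (_ , p) → subtype-≡ (proj₂ (⌊⌋≡true⇒ lem p)))
                 (λ x → f-inj (proj₂ (⌊⌋≡true⇒ lem {InImage (f x)} (⌊⌋≡true lem (x , refl)))))

relabel : (lem : ExcludedMiddle 0ℓ) {X : Set} {N : ℕ} → FiniteSet X →
          (u : Fin N → X) → (∀ {y y′} → u y ≡ u y′ → y ≡ y′) →
          Σ ℕ λ N′ → Σ (X ↔ Fin N′) λ β → ∀ y → toℕ (to β (u y)) ≡ toℕ y
relabel lem {N = N} fX u u-inj = N + r , ↔-trans split↔ numbering , keeps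
  where
  open Complement lem u u-inj
  Rest-finite : FiniteSet Rest
  Rest-finite = FiniteSet-subset fX (λ x → ⌊_⌋ lem (InImage x)) false
  r = proj₁ Rest-finite
  numbering : (Fin N ⊎ Rest) ↔ Fin (N + r)
  numbering = ↔-trans (↔-refl ⊎-cong proj₂ Rest-finite) (↔-sym +↔⊎)
  keeps : ∀ y → toℕ (to numbering (split (u y))) ≡ toℕ y
  keeps y = trans (cong (toℕ ∘ to numbering) (split-u y)) (toℕ-↑ˡ y r)

FiniteAmalgamation : {Op : Set} → Class Op → Set₁
FiniteAmalgamation {Op} K =
  (A B C : Str Op) → FinClass K A → FinClass K B → (i : Emb C A) (j : Emb C B) →
  Σ (Str Op) λ D → FinClass K D × Σ (Emb A D) λ e → Σ (Emb B D) λ h →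
    ∀ c → map e (map i c) ≡ map h (map j c)

next : ℕ × ℕ → ℕ × ℕ
next (a , zero) = 0 , suc a
next (a , suc b) = suc a , b

-- Walks the anti-diagonals of ℕ × ℕ.
unpair : ℕ → ℕ × ℕ
unpair zero = 0 , 0
unpair (suc k) = next (unpair k)

unpair-along-diagonal : ∀ a b → (Σ ℕ λ k → unpair k ≡ (0 , a + b)) → Σ ℕ λ k → unpair k ≡ (a , b)
unpair-along-diagonal zero b start = start
unpair-along-diagonal (suc a) b (k , eq)
  with unpair-along-diagonal a (suc b) (k , trans eq (cong (0 ,_) (sym (+-suc a b))))
... | k′ , eq′ = suc k′ , cong next eq′

unpair-surjective : ∀ a b → Σ ℕ λ k → unpair k ≡ (a , b)
unpair-surjective a b = unpair-along-diagonal a b (diagonal-start (a + b))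
  where
  diagonal-start : ∀ d → Σ ℕ λ k → unpair k ≡ (0 , d)
  diagonal-start zero = 0 , refl
  diagonal-start (suc d) with unpair-along-diagonal d 0 (subst (λ e → Σ ℕ λ k → unpair k ≡ (0 , e))
                                                             (sym (+-identityʳ d)) (diagonal-start d))
  ... | k , eq = suc k , cong next eq

unpair-sum-≤ : ∀ k → proj₁ (unpair k) + proj₂ (unpair k) ≤ k
unpair-sum-≤ zero = z≤n
unpair-sum-≤ (suc k) with unpair k | unpair-sum-≤ k
... | a , zero | a+0≤k = s≤s (subst (_≤ k) (+-identityʳ a) a+0≤k)
... | a , suc b | a+1+b≤k = m≤n⇒m≤1+n (subst (_≤ k) (+-suc a b) a+1+b≤k)

unpair₂-≤ : ∀ k → proj₂ (unpair k) ≤ k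
unpair₂-≤ k = ≤-trans (m≤n+m _ _) (unpair-sum-≤ k)

Enumerable : Set → Set
Enumerable X = Σ (ℕ → Maybe X) λ e → ∀ x → Σ ℕ λ k → e k ≡ just x

Enumerable-surjection : {X Y : Set} (f : X → Y) → (∀ y → Σ X λ x → f x ≡ y) → Enumerable X → Enumerable Y
Enumerable-surjection f f-surj (e , covers) = Maybe.map f ∘ e , λ y →
  let (x , fx≡y) = f-surj y ; (k , ek≡x) = covers x in k , trans (cong (Maybe.map f) ek≡x) (cong just fx≡y)

Enumerable-ℕ : Enumerable ℕ
Enumerable-ℕ = just , λ n → n , refl

Enumerable-Fin : ∀ n → Enumerable (Fin n)
Enumerable-Fin n = e , λ x → toℕ x , e-toℕ x (toℕ x <? n)
  where
  below : ∀ {k} → Dec (k < n) → Maybe (Fin n)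
  below (yes k<n) = just (fromℕ< k<n)
  below (no _) = nothing
  e : ℕ → Maybe (Fin n)
  e k = below (k <? n)
  e-toℕ : ∀ x (d : Dec (toℕ x < n)) → below d ≡ just x
  e-toℕ x (yes x<n) = cong just (fromℕ<-toℕ x x<n)
  e-toℕ x (no x≮n) = ⊥-elim (x≮n (toℕ<n x))

Enumerable-Bool : Enumerable Bool
Enumerable-Bool = Enumerable-surjection (to 2↔Bool) (λ b → from 2↔Bool b , strictlyInverseˡ 2↔Bool b)
                                        (Enumerable-Fin 2)

Enumerable-× : {X Y : Set} → Enumerable X → Enumerable Y → Enumerable (X × Y)
Enumerable-× (e₁ , covers₁) (e₂ , covers₂) = e , covers
  where
  e = λ k → Maybe.zip (e₁ (proj₁ (unpair k))) (e₂ (proj₂ (unpair k)))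
  covers = λ (x , y) →
    let (a , e₁a≡x) = covers₁ x ; (b , e₂b≡y) = covers₂ y ; (k , k↦ab) = unpair-surjective a b in
    k , trans (cong (λ (a , b) → Maybe.zip (e₁ a) (e₂ b)) k↦ab) (cong₂ Maybe.zip e₁a≡x e₂b≡y)

Enumerable-Σℕ : {Y : ℕ → Set} → (∀ a → Enumerable (Y a)) → Enumerable (Σ ℕ Y)
Enumerable-Σℕ {Y} en = e , covers
  where
  e = λ k → Maybe.map (proj₁ (unpair k) ,_) (proj₁ (en (proj₁ (unpair k))) (proj₂ (unpair k)))
  covers = λ (a , y) →
    let (b , eb≡y) = proj₂ (en a) y ; (k , k↦ab) = unpair-surjective a b in
    k , trans (cong (λ (a , b) → Maybe.map (a ,_) (proj₁ (en a) b)) k↦ab) (cong (Maybe.map (a ,_)) eb≡y)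

Enumerable-Vec : {X : Set} → Enumerable X → ∀ n → Enumerable (Vec X n)
Enumerable-Vec en zero = (λ _ → just []) , λ { [] → 0 , refl }
Enumerable-Vec en (suc n) =
  Enumerable-surjection (λ (x , xs) → x ∷ xs) (λ { (x ∷ xs) → (x , xs) , refl })
                        (Enumerable-× en (Enumerable-Vec en n))

record FinStr (Op : Set) (n : ℕ) : Set₁ where
  field
    rel : Fin n → Fin n → Set
    fun : Op → Fin n → Fin n

  str : Str Op
  str = record { Carrier = Fin n ; R = rel ; op = fun }

open FinStr using (str)

module _ {Op : Set} where

  transport : (S : Str Op) {n : ℕ} → Carrier S ↔ Fin n → FinStr Op n
  transport S β = record { rel = λ y y′ → R S (from β y) (from β y′)
                         ; fun = λ o y → to β (op S o (from β y)) }

  toTransport : (S : Str Op) {n : ℕ} (β : Carrier S ↔ Fin n) → Emb S (str (transport S β))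
  toTransport S β = record
    { map = to β
    ; inj = λ x y eq → trans (sym (strictlyInverseʳ β x)) (trans (cong (from β) eq) (strictlyInverseʳ β y))
    ; pres = λ x y r → subst₂ (R S) (sym (strictlyInverseʳ β x)) (sym (strictlyInverseʳ β y)) r
    ; reflect = λ x y r → subst₂ (R S) (strictlyInverseʳ β x) (strictlyInverseʳ β y) r
    ; hom = λ o x → cong (to β ∘ op S o) (sym (strictlyInverseʳ β x)) }

  fromTransport : (S : Str Op) {n : ℕ} (β : Carrier S ↔ Fin n) → Emb (str (transport S β)) S
  fromTransport S β = record
    { map = from β
    ; inj = λ x y eq → trans (sym (strictlyInverseˡ β x)) (trans (cong (to β) eq) (strictlyInverseˡ β y))
    ; pres = λ _ _ r → r
    ; reflect = λ _ _ r → r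
    ; hom = λ o x → strictlyInverseʳ β _ }

lookup-tabulate² : {X : Set} {n k : ℕ} (f : Fin n → Fin k → X) (x : Fin n) (y : Fin k) →
                   lookup (lookup (tabulate (tabulate ∘ f)) x) y ≡ f x y
lookup-tabulate² f x y =
  trans (cong (λ v → lookup v y) (lookup∘tabulate (tabulate ∘ f) x)) (lookup∘tabulate (f x) y)

module Codes (lem : ExcludedMiddle 0ℓ) {Op : Set} {m : ℕ} (opFin : Op ↔ Fin m) where

  Code : ℕ → Set
  Code n = Vec (Vec Bool n) n × Vec (Vec (Fin n) n) m

  decode : ∀ {n} → Code n → FinStr Op n
  decode (rels , funs) = record { rel = λ x y → lookup (lookup rels x) y ≡ true
                                ; fun = λ o x → lookup (lookup funs (to opFin o)) x }

  encode : ∀ {n} → FinStr Op n → Code n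
  encode F = tabulate (λ x → tabulate λ y → ⌊_⌋ lem (FinStr.rel F x y))
           , tabulate (λ k → tabulate λ x → FinStr.fun F (from opFin k) x)

  decode-encode-rel : ∀ {n} (F : FinStr Op n) x y →
                      FinStr.rel (decode (encode F)) x y ≡ (⌊_⌋ lem (FinStr.rel F x y) ≡ true)
  decode-encode-rel F x y = cong (_≡ true) (lookup-tabulate² (λ x y → ⌊_⌋ lem (FinStr.rel F x y)) x y)

  decode-encode-fun : ∀ {n} (F : FinStr Op n) o x → FinStr.fun (decode (encode F)) o x ≡ FinStr.fun F o x
  decode-encode-fun F o x = trans (lookup-tabulate² (λ k x → FinStr.fun F (from opFin k) x) (to opFin o) x)
                                  (cong (λ o → FinStr.fun F o x) (strictlyInverseʳ opFin o))

  encodeᴱ : ∀ {n} (F : FinStr Op n) → Emb (str F) (str (decode (encode F)))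
  encodeᴱ F = record
    { map = λ x → x ; inj = λ _ _ eq → eq
    ; pres = λ x y r → subst (λ P → P) (sym (decode-encode-rel F x y)) (⌊⌋≡true lem r)
    ; reflect = λ x y r → ⌊⌋≡true⇒ lem (subst (λ P → P) (decode-encode-rel F x y) r)
    ; hom = λ o x → sym (decode-encode-fun F o x) }

  decodeᴱ : ∀ {n} (F : FinStr Op n) → Emb (str (decode (encode F))) (str F)
  decodeᴱ F = record
    { map = λ x → x ; inj = λ _ _ eq → eq
    ; pres = λ x y r → ⌊⌋≡true⇒ lem (subst (λ P → P) (decode-encode-rel F x y) r)
    ; reflect = λ x y r → subst (λ P → P) (sym (decode-encode-rel F x y)) (⌊⌋≡true lem r)
    ; hom = λ o x → decode-encode-fun F o x }

  codeOf : (S : Str Op) {n : ℕ} → Carrier S ↔ Fin n → Code n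
  codeOf S β = encode (transport S β)

  toCode : (S : Str Op) {n : ℕ} (β : Carrier S ↔ Fin n) → Emb S (str (decode (codeOf S β)))
  toCode S β = encodeᴱ (transport S β) ∘ᴱ toTransport S β

  fromCode : (S : Str Op) {n : ℕ} (β : Carrier S ↔ Fin n) → Emb (str (decode (codeOf S β))) S
  fromCode S β = fromTransport S β ∘ᴱ decodeᴱ (transport S β)

module Fraisse (lem : ExcludedMiddle 0ℓ) {Op : Set} {m : ℕ} (opFin : Op ↔ Fin m) (K : Class Op)
  (hereditary : ∀ {S T : Str Op} → Emb S T → K T → K S) (K-∅ : K ∅ˢ) (amalgamate : FiniteAmalgamation K)
  where

  open Codes lem opFin

  Stage : Set₁
  Stage = Σ ℕ λ N → Σ (FinStr Op N) λ F → K (str F)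

  size : Stage → ℕ
  size = proj₁

  strOf : Stage → Str Op
  strOf (_ , F , _) = str F

  inK : (st : Stage) → K (strOf st)
  inK (_ , _ , kF) = kF

  _≼_ : Stage → Stage → Set
  st ≼ st′ = Σ (Emb (strOf st) (strOf st′)) λ e → ∀ x → toℕ (map e x) ≡ toℕ x

  ≼-refl : ∀ {st} → st ≼ st
  ≼-refl = idᴱ , λ _ → refl

  ≼-trans : ∀ {st st′ st″} → st ≼ st′ → st′ ≼ st″ → st ≼ st″
  ≼-trans (e , e-toℕ) (f , f-toℕ) = f ∘ᴱ e , λ x → trans (f-toℕ (map e x)) (e-toℕ x)

  -- (n, n′, B, C, f, g): C embeds into B by f and into the current stage at the indices g.
  Task : Set
  Task = Σ ℕ λ n → Σ ℕ λ n′ → Code n × Code n′ × Vec (Fin n) n′ × Vec ℕ n′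

  Enumerable-Code : ∀ n → Enumerable (Code n)
  Enumerable-Code n = Enumerable-× (Enumerable-Vec (Enumerable-Vec Enumerable-Bool n) n)
                                   (Enumerable-Vec (Enumerable-Vec (Enumerable-Fin n) n) m)

  Enumerable-Task : Enumerable Task
  Enumerable-Task = Enumerable-Σℕ λ n → Enumerable-Σℕ λ n′ →
    Enumerable-× (Enumerable-Code n) (Enumerable-× (Enumerable-Code n′)
      (Enumerable-× (Enumerable-Vec (Enumerable-Fin n) n′) (Enumerable-Vec Enumerable-ℕ n′)))

  Valid : Stage → Task → Set
  Valid st (n , n′ , B , C , f , g) =
    Σ (Emb (str (decode C)) (str (decode B))) λ φ → Σ (Emb (str (decode C)) (strOf st)) λ ψ →
      (∀ c → map φ c ≡ lookup f c) × (∀ c → toℕ (map ψ c) ≡ lookup g c) × K (str (decode B))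

  Solved : Stage → Task → Stage → Set
  Solved st (n , n′ , B , C , f , g) st′ = Valid st (n , n′ , B , C , f , g) →
    Σ (Emb (str (decode B)) (strOf st′)) λ w → ∀ c → toℕ (map w (lookup f c)) ≡ lookup g c

  Valid-≼ : ∀ {st st′} t → st ≼ st′ → Valid st t → Valid st′ t
  Valid-≼ _ (e , e-toℕ) (φ , ψ , φ≡f , ψ≡g , kB) =
    φ , e ∘ᴱ ψ , φ≡f , (λ c → trans (e-toℕ (map ψ c)) (ψ≡g c)) , kB

  solve : (st : Stage) (t : Task) → Valid st t → Σ Stage λ st′ → st ≼ st′ × Solved st t st′
  solve st (n , n′ , B , C , f , g) (φ , ψ , φ≡f , ψ≡g , kB)
    with amalgamate (strOf st) (str (decode B)) (str (decode C))
                    (inK st , FiniteSet-Fin _) (kB , FiniteSet-Fin n) ψ φ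
  ... | D , (kD , fD) , e , h , commute with relabel lem fD (map e) (λ {x} {y} → inj e x y)
  ... | N′ , β , β-keeps = st′ , (toTransport D β ∘ᴱ e , β-keeps) , solved
    where
    st′ : Stage
    st′ = N′ , transport D β , hereditary (fromTransport D β) kD
    solved : Solved st (n , n′ , B , C , f , g) st′
    solved _ = toTransport D β ∘ᴱ h , λ c → begin
      toℕ (to β (map h (lookup f c)))  ≡⟨ cong (toℕ ∘ to β ∘ map h) (sym (φ≡f c)) ⟩
      toℕ (to β (map h (map φ c)))     ≡⟨ cong (toℕ ∘ to β) (sym (commute c)) ⟩
      toℕ (to β (map e (map ψ c)))     ≡⟨ β-keeps (map ψ c) ⟩
      toℕ (map ψ c)                    ≡⟨ ψ≡g c ⟩
      lookup g c                       ∎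
      where open ≡-Reasoning

  attempt : (st : Stage) (t : Maybe Task) →
            Σ Stage λ st′ → st ≼ st′ × (∀ t′ → t ≡ just t′ → Solved st t′ st′)
  attempt st nothing = st , ≼-refl {st} , λ _ ()
  attempt st (just t) with lem {Valid st t}
  ... | yes valid = let (st′ , ext , solved) = solve st t valid in st′ , ext , λ { _ refl → solved }
  ... | no invalid = st , ≼-refl {st} , λ { _ refl valid → ⊥-elim (invalid valid) }

  -- Stage r attempts task number proj₁ (unpair r); as proj₂ (unpair r) ≤ r, every task is
  -- attempted at some stage beyond any given one.
  taskAt : ℕ → Maybe Task
  taskAt r = proj₁ Enumerable-Task (proj₁ (unpair r))

  chain : ℕ → Stage
  chain zero = 0 , transport ∅ˢ (↔-sym 0↔⊥) , hereditary (fromTransport ∅ˢ (↔-sym 0↔⊥)) K-∅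
  chain (suc r) = proj₁ (attempt (chain r) (taskAt r))

  chain-step : ∀ r → chain r ≼ chain (suc r)
  chain-step r = proj₁ (proj₂ (attempt (chain r) (taskAt r)))

  chain-solves : ∀ r t → taskAt r ≡ just t → Solved (chain r) t (chain (suc r))
  chain-solves r = proj₂ (proj₂ (attempt (chain r) (taskAt r)))

  chain-≼′ : ∀ {s s′} → s ≤′ s′ → chain s ≼ chain s′
  chain-≼′ {s} ≤′-refl = ≼-refl {chain s}
  chain-≼′ {s} (≤′-step {n} s≤′n) =
    ≼-trans {chain s} {chain n} {chain (suc n)} (chain-≼′ s≤′n) (chain-step n)

  chain-≼ : ∀ {s s′} → s ≤ s′ → chain s ≼ chain s′
  chain-≼ = chain-≼′ ∘ ≤⇒≤′

  stage : ℕ → Str Op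
  stage s = strOf (chain s)

  ∣_∣ : ℕ → ℕ
  ∣ s ∣ = size (chain s)

  embed : ∀ {s s′} → s ≤ s′ → Emb (stage s) (stage s′)
  embed p = proj₁ (chain-≼ p)

  embed-at : ∀ {s s′} (p : s ≤ s′) {y : Fin ∣ s ∣} {y′ : Fin ∣ s′ ∣} → toℕ y ≡ toℕ y′ → map (embed p) y ≡ y′
  embed-at p {y} eq = toℕ-injective (trans (proj₂ (chain-≼ p) y) eq)

  R-coherent : ∀ s s′ {y z : Fin ∣ s ∣} {y′ z′ : Fin ∣ s′ ∣} → toℕ y ≡ toℕ y′ → toℕ z ≡ toℕ z′ →
               R (stage s) y z → R (stage s′) y′ z′
  R-coherent s s′ y≡y′ z≡z′ r with ≤-total s s′
  ... | inj₁ s≤s′ =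
          subst₂ (R (stage s′)) (embed-at s≤s′ y≡y′) (embed-at s≤s′ z≡z′) (pres (embed s≤s′) _ _ r)
  ... | inj₂ s′≤s = reflect (embed s′≤s) _ _
          (subst₂ (R (stage s)) (sym (embed-at s′≤s (sym y≡y′))) (sym (embed-at s′≤s (sym z≡z′))) r)

  op-coherent-≤ : ∀ {s s′} → s ≤ s′ → ∀ o {y : Fin ∣ s ∣} {y′ : Fin ∣ s′ ∣} → toℕ y ≡ toℕ y′ →
                  toℕ (op (stage s) o y) ≡ toℕ (op (stage s′) o y′)
  op-coherent-≤ {s} {s′} p o {y} y≡y′ = begin
    toℕ (op (stage s) o y)                   ≡⟨ sym (proj₂ (chain-≼ p) _) ⟩
    toℕ (map (embed p) (op (stage s) o y))   ≡⟨ cong toℕ (hom (embed p) o y) ⟩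
    toℕ (op (stage s′) o (map (embed p) y))  ≡⟨ cong (toℕ ∘ op (stage s′) o) (embed-at p y≡y′) ⟩
    toℕ (op (stage s′) o _)                  ∎
    where open ≡-Reasoning

  op-coherent : ∀ s s′ o {y : Fin ∣ s ∣} {y′ : Fin ∣ s′ ∣} → toℕ y ≡ toℕ y′ →
                toℕ (op (stage s) o y) ≡ toℕ (op (stage s′) o y′)
  op-coherent s s′ o eq with ≤-total s s′
  ... | inj₁ s≤s′ = op-coherent-≤ s≤s′ o eq
  ... | inj₂ s′≤s = sym (op-coherent-≤ s′≤s o (sym eq))

  Occurs : ℕ → Set
  Occurs x = Σ ℕ λ s → Σ (Fin ∣ s ∣) λ y → toℕ y ≡ x

  Point : Set
  Point = Σ ℕ λ x → ⌊_⌋ lem (Occurs x) ≡ true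

  occurrence : (a : Point) → Occurs (proj₁ a)
  occurrence a = ⌊⌋≡true⇒ lem (proj₂ a)

  ι : ∀ s → Fin ∣ s ∣ → Point
  ι s y = toℕ y , ⌊⌋≡true lem (s , y , refl)

  ι-≡ : ∀ {s s′} {y : Fin ∣ s ∣} {y′ : Fin ∣ s′ ∣} → toℕ y ≡ toℕ y′ → ι s y ≡ ι s′ y′
  ι-≡ = subtype-≡

  Rᴹ : Point → Point → Set
  Rᴹ a b = Σ ℕ λ s → Σ (Fin ∣ s ∣) λ y → Σ (Fin ∣ s ∣) λ z →
    toℕ y ≡ proj₁ a × toℕ z ≡ proj₁ b × R (stage s) y z

  opᴹ : Op → Point → Point
  opᴹ o a = let (s , y , _) = occurrence a in ι s (op (stage s) o y)

  M : Str Op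
  M = record { Carrier = Point ; R = Rᴹ ; op = opᴹ }

  ιᴱ : ∀ s → Emb (stage s) M
  ιᴱ s = record
    { map = ι s
    ; inj = λ y z eq → toℕ-injective (cong proj₁ eq)
    ; pres = λ y z r → s , y , z , refl , refl , r
    ; reflect = λ { y z (s′ , y′ , z′ , y′≡y , z′≡z , r) → R-coherent s′ s y′≡y z′≡z r }
    ; hom = λ o y → let (s′ , y′ , y′≡y) = occurrence (ι s y) in ι-≡ (op-coherent s s′ o (sym y′≡y)) }

  point-at-stage : ∀ a → Σ ℕ λ s → Σ (Fin ∣ s ∣) λ y → ι s y ≡ a
  point-at-stage a = let (s , y , y≡a) = occurrence a in s , y , subtype-≡ y≡a

  ι-embed : ∀ {s s′} (p : s ≤ s′) y → ι s′ (map (embed p) y) ≡ ι s y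
  ι-embed p y = ι-≡ (proj₂ (chain-≼ p) y)

  AtStage : ℕ → Point → Set
  AtStage s x = Σ (Fin ∣ s ∣) λ y → ι s y ≡ x

  AtStage-≤ : ∀ {s s′ x} → s ≤ s′ → AtStage s x → AtStage s′ x
  AtStage-≤ p (y , eq) = map (embed p) y , trans (ι-embed p y) eq

  Within : {A : Str Op} → ℕ → Emb A M → Set
  Within s e = ∀ a → AtStage s (map e a)

  Bounded : {A : Str Op} → Emb A M → Set
  Bounded e = Σ ℕ λ s → Within s e

  Within⇒Emb : {A : Str Op} (e : Emb A M) (s : ℕ) → Within s e → Emb A (stage s)
  Within⇒Emb e s within = corestrict (ιᴱ s) e (proj₁ ∘ within) (proj₂ ∘ within)

  eventually-solved : ∀ s t → Valid (chain s) t →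
                      Σ ℕ λ r → Valid (chain r) t × Solved (chain r) t (chain (suc r))
  eventually-solved s t valid =
    r , Valid-≼ {chain s} {chain r} t (chain-≼ s≤r) valid
      , chain-solves r t (trans (cong (proj₁ Enumerable-Task ∘ proj₁) r↦ks) k↦t)
    where
    k = proj₁ (proj₂ Enumerable-Task t)
    k↦t = proj₂ (proj₂ Enumerable-Task t)
    r = proj₁ (unpair-surjective k s)
    r↦ks = proj₂ (unpair-surjective k s)
    s≤r : s ≤ r
    s≤r = subst (λ (_ , s) → s ≤ r) r↦ks (unpair₂-≤ r)

  extension : (A : Str Op) → FiniteSet (Carrier A) → (e : Emb A M) → Bounded e →
              (B : Str Op) → FinClass K B → (g : Emb A B) →
              Σ (Emb B M) λ h → Bounded h × ∀ a → map h (map g a) ≡ map e a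
  extension A (n′ , βA) e (s , e-within) B (kB , n , βB) g =
    h , (suc r , λ _ → _ , refl) , h∘g≡e
    where
    e′ = Within⇒Emb e s e-within
    φ : Emb (str (decode (codeOf A βA))) (str (decode (codeOf B βB)))
    φ = toCode B βB ∘ᴱ g ∘ᴱ fromCode A βA
    ψ : Emb (str (decode (codeOf A βA))) (stage s)
    ψ = e′ ∘ᴱ fromCode A βA
    t : Task
    t = n , n′ , codeOf B βB , codeOf A βA , tabulate (map φ) , tabulate (toℕ ∘ map ψ)
    valid : Valid (chain s) t
    valid = φ , ψ
          , (λ c → sym (lookup∘tabulate (map φ) c)) , (λ c → sym (lookup∘tabulate (toℕ ∘ map ψ) c))
          , hereditary (fromCode B βB) kB
    r = proj₁ (eventually-solved s t valid)
    solution = let (_ , valid′ , solved) = eventually-solved s t valid in solved valid′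
    w = proj₁ solution
    h : Emb B M
    h = ιᴱ (suc r) ∘ᴱ w ∘ᴱ toCode B βB
    h∘g≡e : ∀ a → map h (map g a) ≡ map e a
    h∘g≡e a = begin
      ι (suc r) (map w (to βB (map g a)))
        ≡⟨ cong (ι (suc r) ∘ map w ∘ to βB ∘ map g) (sym (strictlyInverseʳ βA a)) ⟩
      ι (suc r) (map w (map φ (to βA a)))
        ≡⟨ cong (ι (suc r) ∘ map w) (sym (lookup∘tabulate (map φ) (to βA a))) ⟩
      ι (suc r) (map w (lookup (tabulate (map φ)) (to βA a)))
        ≡⟨ ι-≡ (trans (proj₂ solution (to βA a)) (lookup∘tabulate (toℕ ∘ map ψ) (to βA a))) ⟩
      ι s (map e′ (from βA (to βA a)))
        ≡⟨ cong (ι s ∘ map e′) (strictlyInverseʳ βA a) ⟩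
      ι s (map e′ a)
        ≡⟨ proj₂ (e-within a) ⟩
      map e a ∎
      where open ≡-Reasoning

  list-at-stage : (xs : List Point) → Σ ℕ λ s → ∀ x → x ∈ xs → AtStage s x
  list-at-stage [] = 0 , λ _ ()
  list-at-stage (x ∷ xs) =
    let (s₁ , y , y≡x) = point-at-stage x ; (s₂ , xs-at) = list-at-stage xs in
    s₁ ⊔ s₂ , λ { _ (here refl) → AtStage-≤ (m≤m⊔n s₁ s₂) (y , y≡x)
                ; z (there z∈xs) → AtStage-≤ (m≤n⊔m s₁ s₂) (xs-at z z∈xs) }

  generated-at-stage : ∀ {xs} s → (∀ x → x ∈ xs → AtStage s x) → ∀ z → Gen M xs z → AtStage s z
  generated-at-stage s xs-at z (base z∈xs) = xs-at z z∈xs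
  generated-at-stage s xs-at _ (step o gen) =
    let (y , eq) = generated-at-stage s xs-at _ gen in op (stage s) o y , trans (hom (ιᴱ s) o y) (cong (opᴹ o) eq)

  finGen⇒bounded : {S : Str Op} {e : Emb S M} → FinGenSub e → Bounded e
  finGen⇒bounded {e = e} (xs , _ , gen) =
    let (s , xs-at) = list-at-stage xs in s , λ a → generated-at-stage s xs-at (map e a) (gen a)

  age-⊆ : (S : Str Op) (e : Emb S M) → FinGenSub e → FinClass K S
  age-⊆ S e fg =
    hereditary e′ (inK (chain s))
    , FiniteSet-injection lem (FiniteSet-Fin ∣ s ∣) (map e′) (λ {x} {y} → inj e′ x y)
    where
    bounded = finGen⇒bounded {S} {e} fg
    s = proj₁ bounded
    e′ = Within⇒Emb e s (proj₂ bounded)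

  age-⊇ : (A : Str Op) → FinClass K A → Emb A M
  age-⊇ A fA = proj₁ (extension ∅ˢ (0 , ↔-sym 0↔⊥) ∅ᴱ (0 , λ ()) A fA ∅ᴱ)

  countable : Countable M
  countable = proj₁ , λ _ _ → subtype-≡

  -- The finite partial isomorphism v ∘ u⁻¹ of M.
  record PartialIso : Set₁ where
    field
      dom : Str Op
      dom-finite : FiniteSet (Carrier dom)
      u v : Emb dom M
      u-bounded : Bounded u
      v-bounded : Bounded v

  open PartialIso

  _⊆ᴾ_ : PartialIso → PartialIso → Set
  p ⊆ᴾ p′ = Σ (Carrier (dom p) → Carrier (dom p′)) λ g →
    (∀ a → map (u p′) (g a) ≡ map (u p) a) × (∀ a → map (v p′) (g a) ≡ map (v p) a)

  ⊆ᴾ-refl : ∀ {p} → p ⊆ᴾ p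
  ⊆ᴾ-refl = (λ a → a) , (λ _ → refl) , (λ _ → refl)

  ⊆ᴾ-trans : ∀ {p p′ p″} → p ⊆ᴾ p′ → p′ ⊆ᴾ p″ → p ⊆ᴾ p″
  ⊆ᴾ-trans (g , gu , gv) (g′ , gu′ , gv′) =
    g′ ∘ g , (λ a → trans (gu′ (g a)) (gu a)) , (λ a → trans (gv′ (g a)) (gv a))

  swap : PartialIso → PartialIso
  swap p = record { dom = dom p ; dom-finite = dom-finite p ; u = v p ; v = u p
                  ; u-bounded = v-bounded p ; v-bounded = u-bounded p }

  Covers : ((p : PartialIso) → Emb (dom p) M) → ℕ → PartialIso → Set
  Covers side k p = ∀ x → proj₁ x ≡ k → InIm (side p) x

  forth : (p : PartialIso) (k : ℕ) → Σ PartialIso λ p′ → p ⊆ᴾ p′ × Covers u k p′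
  forth p k with lem {Σ Point λ x → proj₁ x ≡ k}
  ... | no none = p , ⊆ᴾ-refl {p} , λ x x≡k → ⊥-elim (none (x , x≡k))
  ... | yes (x , x≡k) = p′ , (map g , (λ a → proj₂ (u-within a)) , proj₂ (proj₂ ext)) , covers
    where
    sx = proj₁ (point-at-stage x)
    su = proj₁ (u-bounded p)
    s = su ⊔ sx
    u-within : Within s (u p)
    u-within a = AtStage-≤ (m≤m⊔n su sx) (proj₂ (u-bounded p) a)
    g : Emb (dom p) (stage s)
    g = Within⇒Emb (u p) s u-within
    ext = extension (dom p) (dom-finite p) (v p) (v-bounded p) (stage s) (inK (chain s) , FiniteSet-Fin _) g
    p′ : PartialIso
    p′ = record { dom = stage s ; dom-finite = FiniteSet-Fin _ ; u = ιᴱ s ; v = proj₁ ext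
                ; u-bounded = s , (λ y → y , refl) ; v-bounded = proj₁ (proj₂ ext) }
    covers : Covers u k p′
    covers x′ x′≡k = let (y , y↦x) = AtStage-≤ (m≤n⊔m su sx) (proj₂ (point-at-stage x)) in
      y , trans y↦x (subtype-≡ (trans x≡k (sym x′≡k)))

  back : (p : PartialIso) (k : ℕ) → Σ PartialIso λ p′ → p ⊆ᴾ p′ × Covers v k p′
  back p k = let (p′ , (g , gu , gv) , covers) = forth (swap p) k in swap p′ , (g , gv , gu) , covers

  module BackAndForth (p₀ : PartialIso) where

    -- Round k makes the point with index k lie in the domain and in the range.
    seq : ℕ → PartialIso
    seq zero = p₀
    seq (suc k) = proj₁ (back (proj₁ (forth (seq k) k)) k)

    seq-step : ∀ k → seq k ⊆ᴾ seq (suc k)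
    seq-step k = ⊆ᴾ-trans {seq k} {proj₁ (forth (seq k) k)} {seq (suc k)}
                 (proj₁ (proj₂ (forth (seq k) k))) (proj₁ (proj₂ (back _ k)))

    seq-covers-u : ∀ k → Covers u k (seq (suc k))
    seq-covers-u k x x≡k =
      let (a , ua≡x) = proj₂ (proj₂ (forth (seq k) k)) x x≡k ; (g , gu , _) = proj₁ (proj₂ (back _ k)) in
      g a , trans (gu a) ua≡x

    seq-covers-v : ∀ k → Covers v k (seq (suc k))
    seq-covers-v k = proj₂ (proj₂ (back _ k))

    seq-≤′ : ∀ {k k′} → k ≤′ k′ → seq k ⊆ᴾ seq k′
    seq-≤′ {k} ≤′-refl = ⊆ᴾ-refl {seq k}
    seq-≤′ {k} (≤′-step {n} k≤′n) =
      ⊆ᴾ-trans {seq k} {seq n} {seq (suc n)} (seq-≤′ k≤′n) (seq-step n)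

    uₖ vₖ : ∀ k → Carrier (dom (seq k)) → Point
    uₖ k = map (u (seq k))
    vₖ k = map (v (seq k))

    coherent : ∀ k₁ k₂ a₁ a₂ → uₖ k₁ a₁ ≡ uₖ k₂ a₂ → vₖ k₁ a₁ ≡ vₖ k₂ a₂
    coherent k₁ k₂ a₁ a₂ eq with ≤-total k₁ k₂
    ... | inj₁ k₁≤k₂ = let (g , gu , gv) = seq-≤′ (≤⇒≤′ k₁≤k₂) in
      trans (sym (gv a₁)) (cong (vₖ k₂) (inj (u (seq k₂)) _ _ (trans (gu a₁) eq)))
    ... | inj₂ k₂≤k₁ = let (g , gu , gv) = seq-≤′ (≤⇒≤′ k₂≤k₁) in
      trans (cong (vₖ k₁) (inj (u (seq k₁)) _ _ (trans eq (sym (gu a₂))))) (gv a₂)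

    preimage : ∀ x → Σ ℕ λ k → Σ (Carrier (dom (seq k))) λ a → uₖ k a ≡ x
    preimage x = suc (proj₁ x) , seq-covers-u (proj₁ x) x refl

    σ : Point → Point
    σ x = let (k , a , _) = preimage x in vₖ k a

    σ-uₖ : ∀ k a → σ (uₖ k a) ≡ vₖ k a
    σ-uₖ k a = let (k′ , a′ , eq) = preimage (uₖ k a) in coherent k′ k a′ a eq

    common-preimage : ∀ x y → Σ ℕ λ k → Σ (Carrier (dom (seq k))) λ a → Σ (Carrier (dom (seq k))) λ b →
                      uₖ k a ≡ x × uₖ k b ≡ y
    common-preimage x y =
      let (kx , a , a↦x) = preimage x ; (ky , b , b↦y) = preimage y
          (g , gu , _) = seq-≤′ {kx} {kx ⊔ ky} (≤⇒≤′ (m≤m⊔n kx ky))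
          (g′ , gu′ , _) = seq-≤′ {ky} {kx ⊔ ky} (≤⇒≤′ (m≤n⊔m kx ky)) in
      kx ⊔ ky , g a , g′ b , trans (gu a) a↦x , trans (gu′ b) b↦y

    σᴱ : Emb M M
    σᴱ = record { map = σ ; inj = σ-inj ; pres = σ-pres ; reflect = σ-reflect ; hom = σ-hom }
      where
      σ-inj : ∀ x y → σ x ≡ σ y → x ≡ y
      σ-inj x y eq with common-preimage x y
      ... | k , a , b , refl , refl =
        cong (uₖ k) (inj (v (seq k)) a b (trans (sym (σ-uₖ k a)) (trans eq (σ-uₖ k b))))
      σ-pres : ∀ x y → Rᴹ x y → Rᴹ (σ x) (σ y)
      σ-pres x y r with common-preimage x y
      ... | k , a , b , refl , refl =
        subst₂ Rᴹ (sym (σ-uₖ k a)) (sym (σ-uₖ k b)) (pres (v (seq k)) a b (reflect (u (seq k)) a b r))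
      σ-reflect : ∀ x y → Rᴹ (σ x) (σ y) → Rᴹ x y
      σ-reflect x y r with common-preimage x y
      ... | k , a , b , refl , refl =
        pres (u (seq k)) a b (reflect (v (seq k)) a b (subst₂ Rᴹ (σ-uₖ k a) (σ-uₖ k b) r))
      σ-hom : ∀ o x → σ (opᴹ o x) ≡ opᴹ o (σ x)
      σ-hom o x with preimage x
      ... | k , a , refl = begin
        σ (opᴹ o (uₖ k a))         ≡⟨ cong σ (sym (hom (u (seq k)) o a)) ⟩
        σ (uₖ k (op (dom (seq k)) o a)) ≡⟨ σ-uₖ k _ ⟩
        vₖ k (op (dom (seq k)) o a) ≡⟨ hom (v (seq k)) o a ⟩
        opᴹ o (vₖ k a)             ≡⟨ cong (opᴹ o) (sym (σ-uₖ k a)) ⟩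
        opᴹ o (σ (uₖ k a))         ∎
        where open ≡-Reasoning

    σ-surjective : ∀ y → InIm σᴱ y
    σ-surjective y = let (b , b↦y) = seq-covers-v (proj₁ y) y refl in
      uₖ (suc (proj₁ y)) b , trans (σ-uₖ _ b) b↦y

  ultrahomogeneous : Ultrahomogeneous M
  ultrahomogeneous S₁ S₂ e₁ e₂ fg₁ fg₂ (φ , _) = (σᴱ , σ-surjective) , σ-uₖ 0
    where
    p₀ : PartialIso
    p₀ = record { dom = S₁ ; dom-finite = proj₂ (age-⊆ S₁ e₁ fg₁) ; u = e₁ ; v = e₂ ∘ᴱ φ
                ; u-bounded = finGen⇒bounded {S₁} {e₁} fg₁
                ; v-bounded = let (s , within) = finGen⇒bounded {S₂} {e₂} fg₂ in s , within ∘ map φ }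
    open BackAndForth p₀

  Fraïssé-limit : HasFraisseLimit (FinClass K)
  Fraïssé-limit = M , countable , ultrahomogeneous , age-⊇ , age-⊆

module _ (lem : ExcludedMiddle 0ℓ) {Op : Set} (K : Class Op) (G : Set)
         (trans : ∀ {A} → K A → G → Transitive (R A)) (closed : ClosedUnderAmalgams lem K G trans) where

  superSAP-of-amalgams : SuperSAP K
  superSAP-of-amalgams A B C kA kB _ i j =
    D , closed i j kA kB , fromA , fromBᴱ , commutes , meet , super
    where open Amalgam lem i j G (trans kA) (trans kB)

  JEP-of-amalgams : K ∅ˢ → JEP K
  JEP-of-amalgams K-∅ A B kA kB =
    let (D , kD , e , h , _) = superSAP-of-amalgams A B ∅ˢ kA kB K-∅ ∅ᴱ ∅ᴱ in D , kD , e , h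

  finiteAmalgamation-of-amalgams : FiniteAmalgamation K
  finiteAmalgamation-of-amalgams A B C (kA , fA) (kB , fB) i j =
    D , (closed i j kA kB , FiniteSet-⊎ fA (FiniteSet-subset fB (λ b → ⌊_⌋ lem (InImage b)) false))
    , fromA , fromBᴱ , commutes
    where open Amalgam lem i j G (trans kA) (trans kB)

  amalgamation-properties : (∀ {S T : Str Op} → Emb S T → K T → K S) → K ∅ˢ →
                            SuperSAP K × JEP K × (FiniteSet Op → HasFraisseLimit (FinClass K))
  amalgamation-properties hereditary K-∅ = superSAP-of-amalgams , JEP-of-amalgams K-∅ , λ (_ , opFin) →
    Fraisse.Fraïssé-limit lem opFin K hereditary K-∅ finiteAmalgamation-of-amalgams

corollary2p3 : ExcludedMiddle 0ℓ →
    ((k : Kind) (F G : Set) →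
        SuperSAP (Class1 k F G) × JEP (Class1 k F G)
      × (FiniteSet F → FiniteSet G → HasFraisseLimit (FinClass (Class1 k F G))))
    × ((F₁ F₂ F₃ F₄ : Set) →
        SuperSAP (Class2 F₁ F₂ F₃ F₄) × JEP (Class2 F₁ F₂ F₃ F₄)
      × (FiniteSet F₁ → FiniteSet F₂ → FiniteSet F₃ → FiniteSet F₄ →
           HasFraisseLimit (FinClass (Class2 F₁ F₂ F₃ F₄))))
corollary2p3 lem = part1 , part2
  where
  part1 = λ k F G →
    let (sap , jep , limit) = amalgamation-properties lem (Class1 k F G) (TransitiveKind k)
                                (λ kA → RelAx⇒transitive k (proj₁ kA)) (Class1-amalgam lem k F G)
                                (Class1-hereditary k F G) (Class1-∅ k F G)
    in sap , jep , λ fF fG → limit (FiniteSet-⊎ fF fG)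
  part2 = λ F₁ F₂ F₃ F₄ →
    let (sap , jep , limit) = amalgamation-properties lem (Class2 F₁ F₂ F₃ F₄) ⊤
                                (λ kA → RelAx⇒transitive poset (proj₁ kA)) (Class2-amalgam lem F₁ F₂ F₃ F₄)
                                (Class2-hereditary F₁ F₂ F₃ F₄) (Class2-∅ F₁ F₂ F₃ F₄)
    in sap , jep , λ f₁ f₂ f₃ f₄ → limit (FiniteSet-⊎ f₁ (FiniteSet-⊎ f₂ (FiniteSet-⊎ f₃ f₄)))
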